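{- Let $\sigma$ be an address and let $\mathbb{N}at=\{\mathbf{n}_\sigma \mid n\in\mathbb{N}\}$ be the set of designs on base $\vdash\sigma$ representing natural numbers. Then $\mathbb{N}at$ is principal: every element of $\mathbb{N}at$ is $\maltese$-free and $|\mathbb{N}at^{\perp\perp}|=\mathbb{N}at^{\maltese}$.
   Context: Ludics (Girard). An address is a finite sequence of natural numbers; $\xi.i$ denotes the extension of $\xi$ by $i$. An action is a proper positive action $(+,\xi,I)$, a proper negative action $(-,\xi,I)$ ($\xi$ an address, $I$ a finite set of naturals called the ramification), or the daimon $\maltese$ (a positive action). An action with address $\xi.i$ is justified by an action of opposite polarity with address $\xi$ whose ramification contains $i$. A base is $\Gamma\vdash\Delta$ with $\Gamma$ containing at most one address, $\Delta$ a finite set of addresses, all addresses pairwise disjoint (none a prefix of another); it is positive if $\Gamma$ is empty. A chronicle on $\Gamma\vdash\Delta$ is a nonempty finite sequence of actions of alternating polarity such that each proper action is either initial (a first negative action with address in $\Gamma$, or a positive action with address in $\Delta$) or justified by an earlier action, a non-initial negative action being justified by the immediately preceding action; addresses are pairwise distinct; $\maltese$, if present, is last. Two chronicles are coherent if one extends the other or they first differ on negative actions, and in the latter case if these negative actions have distinct addresses then all subsequent actions of the two have pairwise distinct addresses. A design on a base is a set of chronicles on it that is prefix-closed, pairwise coherent, whose maximal chronicles end with a positive action, and which, for a positive base, is nonempty with all chronicles starting with the same positive action. A design is $\maltese$-free if no chronicle contains $\maltese$. Interaction: for a closed cut-net (finite set of designs in which each base address occurs exactly twice, once on each side of $\vdash$,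 with acyclic connected graph of cuts), normalization starts from the unique positive design: if its first action is $\maltese$ the result is $\{\maltese\}$; if it is $(+,\sigma,I)$ then $\sigma$ is cut with a design whose chronicles begin with negative actions on $\sigma$; if none has ramification $I$ interaction fails, otherwise it continues with the subdesigns above $(+,\sigma,I)$ and above $(-,\sigma,I)$ (non-terminating interaction also fails). A design $\mathfrak D$ and a design (or net) $\mathfrak R$ are orthogonal, $\mathfrak D\perp\mathfrak R$, if their normalization is $\{\maltese\}$. For a set $E$ of designs on the same base, $E^\perp$ is the set of designs orthogonal to every element of $E$. Incarnation: for a set $\mathbf G$ of designs, $|\mathfrak D|_{\mathbf G}=\bigcap\{\mathfrak D'\subseteq\mathfrak D\mid \mathfrak D'\in\mathbf G\}$; $\mathfrak D$ is material in $\mathbf G$ if $\mathfrak D=|\mathfrak D|_{\mathbf G}$, and $|\mathbf G|$ is the set of material designs of $\mathbf G$. $\maltese$-shortening: a $\maltese$-shorten of a chronicle $\mathfrak c$ is $\mathfrak c$ itself or $\mathfrak c_1\maltese$ where $\mathfrak c=\mathfrak c_1\mathfrak c_2$ and $\mathfrak c_1$ ends with a negative action; $E^{\maltese}$ is the set of designs obtained from designs of $E$ by $\maltese$-shortening chronicles. A set $E$ is principal if its elements are $\maltese$-free and $|E^{\perp\perp}|=E^{\maltese}$. Natural numbers: set $\overline 0=\epsilon$ (empty sequence), $\overline{k+1}=\overline k.0.1$. The design $\mathbf n_\sigma$ on base $\vdash\sigma$ is defined by $\mathbf 0_\sigma=\{(+,\sigma,\emptyset)\}$ and $(\mathbf{n+1})_\sigma=$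 the prefix closure of $\{(+,\sigma,\{0\})(-,\sigma.0,\{1\})\mathfrak c \mid \mathfrak c\in\mathbf n_{\sigma.0.1}\}$; thus $\mathbf n_\sigma$ has a single maximal chronicle $(+,\sigma,\{0\})(-,\sigma.0,\{1\})(+,\sigma.\overline1,\{0\})(-,\sigma.\overline1.0,\{1\})\cdots(+,\sigma.\overline n,\emptyset)$. -}

module Defs where

open import Data.Nat using (ℕ; _<_)
open import Data.List using (List; []; _∷_; _++_; [_]; _∷ʳ_; map)
open import Data.List.Membership.Propositional using (_∈_; _∉_)
open import Data.List.Relation.Unary.Unique.Propositional using (Unique)
open import Data.List.Relation.Unary.Linked using (Linked)
open import Data.Maybe using (Maybe; just; nothing)
open import Data.Product using (Σ; ∃; _×_; _,_; ∃-syntax)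
open import Data.Sum using (_⊎_)
open import Data.Unit using (⊤)
open import Relation.Binary.PropositionalEquality using (_≡_; _≢_)
open import Relation.Nullary using (¬_)
import Level
open import Level using (Lift)

Address : Set
Address = List ℕ

_·_ : Address → ℕ → Address
ξ · i = ξ ++ [ i ]

data Pol : Set where
  pos neg : Pol

-- A proper action (P, ξ, I); the ramification I (a finite set of
-- naturals) is represented canonically as a strictly increasing list
-- (enforced in the definition of chronicle).  ✠ is 'daimon'.
data Action : Set where
  prop   : Pol → Address → List ℕ → Action
  daimon : Action

pol : Action → Pol
pol (prop p _ _) = p
pol daimon       = pos

addrOf : Action → Maybe Address
addrOf (prop _ ξ _) = just ξ
addrOf daimon       = nothing

addrs : List Action → List Address
addrs []                 = []
addrs (prop _ ξ _ ∷ as) = ξ ∷ addrs as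
addrs (daimon ∷ as)     = addrs as

Chronicle : Set
Chronicle = List Action

_⊑_ : Chronicle → Chronicle → Set
c ⊑ c' = ∃[ d ] (c ++ d ≡ c')

record Base : Set where
  constructor _⊢_
  field
    Γ : Maybe Address
    Δ : List Address
open Base public

Alternating : Chronicle → Set
Alternating []            = ⊤
Alternating (a ∷ [])      = ⊤
Alternating (a ∷ b ∷ cs) = (pol a ≢ pol b) × Alternating (b ∷ cs)

ActOK : Base → Chronicle → Action → Set
ActOK B p daimon = ⊤
ActOK B p (prop pos ξ I) =
  Linked _<_ I ×
  ( (ξ ∈ Δ B)
  ⊎ (∃[ ζ ] ∃[ J ] ∃[ i ] (prop neg ζ J ∈ p × i ∈ J × ξ ≡ ζ · i)))
ActOK B p (prop neg ξ I) =
  Linked _<_ I ×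
  ( (p ≡ [] × Γ B ≡ just ξ)
  ⊎ (∃[ p' ] ∃[ ζ ] ∃[ J ] ∃[ i ]
       (p ≡ p' ∷ʳ prop pos ζ J × i ∈ J × ξ ≡ ζ · i)))

IsChronicle : Base → Chronicle → Set
IsChronicle B c =
  (c ≢ []) ×
  Alternating c ×
  (∀ p a q → c ≡ p ++ (a ∷ q) → ActOK B p a) ×
  Unique (addrs c) ×
  (∀ p q → c ≡ p ++ (daimon ∷ q) → q ≡ [])

Coherent : Chronicle → Chronicle → Set
Coherent c c' =
  (c ⊑ c') ⊎ (c' ⊑ c) ⊎
  (∃[ p ] ∃[ a ] ∃[ a' ] ∃[ q ] ∃[ q' ]
     ( c ≡ p ++ (a ∷ q) × c' ≡ p ++ (a' ∷ q') × a ≢ a'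
     × pol a ≡ neg × pol a' ≡ neg
     × (addrOf a ≢ addrOf a' →
          ∀ x → x ∈ addrs q → x ∉ addrs q')))

Des : Set₁
Des = Chronicle → Set

_⊆D_ : Des → Des → Set
D ⊆D D' = ∀ c → D c → D' c

IsDesign : Base → Des → Set
IsDesign B D =
  (∀ c → D c → IsChronicle B c) ×
  (∀ c d → D (c ++ d) → c ≢ [] → D c) ×
  (∀ c c' → D c → D c' → Coherent c c') ×
  (∀ c → D c → (∀ c' → D c' → c ⊑ c' → c' ≡ c) →
     ∃[ p ] ∃[ a ] (c ≡ p ∷ʳ a × pol a ≡ pos)) ×
  (Γ B ≡ nothing →
     (∃[ c ] D c) ×
     (∃[ a ] (pol a ≡ pos × (∀ c → D c → ∃[ q ] (c ≡ a ∷ q)))))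

DaimonFree : Des → Set
DaimonFree D = ∀ c → D c → daimon ∉ c

-- A cut-net reached during normalisation consists of subdesigns of D
-- and E; each is identified by a side and the chronicle prefix above
-- which it lies.  The current positive design is (side s, prefix c);
-- the pending negative designs are "slots" (ξ, s, c): the subdesign of
-- side s made of the chronicles  c (-,ξ,_) ...  (cut on address ξ).

data Side : Set where
  left right : Side

sel : Des → Des → Side → Des
sel D E left  = D
sel D E right = E

record Slot : Set where
  constructor slot
  field
    sAddr : Address
    sSide : Side
    sPre  : Chronicle

-- Normalisation (from the given state) terminates with {✠}
data Conv (D E : Des) : Side → Chronicle → List Slot → Set where
  done : ∀ {s c sl} → sel D E s (c ∷ʳ daimon) → Conv D E s c sl
  step : ∀ {s c sl} ξ I s' c' xs ys →
         sel D E s (c ∷ʳ prop pos ξ I) →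
         sl ≡ xs ++ (slot ξ s' c' ∷ ys) →
         sel D E s' (c' ∷ʳ prop neg ξ I) →
         Conv D E s' (c' ∷ʳ prop neg ξ I)
              (xs ++ ys ++ map (λ i → slot (ξ · i) s (c ∷ʳ prop pos ξ I)) I) →
         Conv D E s c sl

Orth : Address → Des → Des → Set
Orth σ D E = Conv D E left [] (slot σ right [] ∷ [])

SetD : Set₂
SetD = Des → Set₁

Perp⁺ : Address → SetD → SetD
Perp⁺ σ G E = IsDesign (just σ ⊢ []) E × (∀ D → G D → Orth σ D E)

Perp⁻ : Address → SetD → SetD
Perp⁻ σ H D = IsDesign (nothing ⊢ (σ ∷ [])) D × (∀ E → H E → Orth σ D E)

Biorth : Address → SetD → SetD
Biorth σ G = Perp⁻ σ (Perp⁺ σ G)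

Incarnation : SetD → Des → Chronicle → Set₁
Incarnation G D c = ∀ D' → D' ⊆D D → G D' → D' c

Material : SetD → SetD
Material G D = G D × (∀ c → (D c → Incarnation G D c) × (Incarnation G D c → D c))

Shorten : Chronicle → Chronicle → Set
Shorten c c' =
  (c' ≡ c) ⊎
  (∃[ c₁ ] ∃[ c₂ ]
     ( c ≡ c₁ ++ c₂
     × ((c₁ ≡ []) ⊎ (∃[ p ] ∃[ a ] (c₁ ≡ p ∷ʳ a × pol a ≡ neg)))
     × c' ≡ c₁ ∷ʳ daimon))

ShortenedFrom : Base → Des → Des → Set
ShortenedFrom B D D' =
  IsDesign B D' ×
  (∀ c → D c → ∃[ c' ] (Shorten c c' × D' c')) ×
  (∀ c' → D' c' → ∃[ c ] ∃[ c'' ] (D c × Shorten c c'' × c' ⊑ c''))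

DaimonShort : Base → SetD → SetD
DaimonShort B G D' = ∃[ D ] (G D × ShortenedFrom B D D')

Principal : Address → SetD → Set₁
Principal σ G =
  (∀ D → G D → DaimonFree D) ×
  (∀ D → (Material (Biorth σ G) D → DaimonShort (nothing ⊢ (σ ∷ [])) G D)
       × (DaimonShort (nothing ⊢ (σ ∷ [])) G D → Material (Biorth σ G) D))

PrefClos : Des → Des
PrefClos S c = (c ≢ []) × ∃[ c' ] (S c' × c ⊑ c')

natD : ℕ → Address → Des
natD ℕ.zero    σ c = c ≡ prop pos σ [] ∷ []
natD (ℕ.suc n) σ = PrefClos (λ c → ∃[ c' ]
  (natD n ((σ · 0) · 1) c' × c ≡ prop pos σ (0 ∷ []) ∷ prop neg (σ · 0) (1 ∷ []) ∷ c'))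

_≐_ : Des → Des → Set
D ≐ D' = (D ⊆D D') × (D' ⊆D D)

NatSet : Address → SetD
NatSet σ D = Lift (Level.suc Level.zero) (∃[ n ] (D ≐ natD n σ))

module Submission where

-- The designs that matter are prefix closures  Chain L  of a single chronicle
-- L.  The key chronicles are the *spines*: k unfoldings
-- (+,τ,{0})(-,τ.0,{1}) of a numeral, ending either with the numeral's last
-- action (+,τ_k,∅) or with the daimon.  The numeral n_σ is the spine with
-- n unfoldings ending with (+,σ_n,∅); the other spines are its ✠-shortens.
--
-- Interaction is studied against the *tester* T_σ on σ ⊢, the design whose
-- maximal chronicles answer k unfoldings and then play (-,σ_k,∅)✠.  The
-- tester is orthogonal to every numeral, so it lies in ℕat^⊥, and any design
-- converging against it contains a whole spine.  Conversely a spine converges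
-- against every element of ℕat^⊥, because its interaction with any E is the
-- interaction of the corresponding numeral, possibly cut short by ✠.
--
-- Hence a design lies in ℕat^⊥⊥ iff it contains a spine, a material one is
-- exactly (the chain of) a spine, and the designs of ℕat^✠ are exactly the
-- chains of spines: both sides of  |ℕat^⊥⊥| = ℕat^✠  are the spines.

open import Defs
open import Data.Nat using (ℕ; zero; suc; _≤_; _<_; s≤s)
open import Data.Nat.Properties using (≤-refl; ≤-trans; <-irrefl; <-trans; <-≤-trans; <⇒≤)
open import Data.List using (List; []; _∷_; _++_; [_]; _∷ʳ_; map; length)
open import Data.List.Properties
  using (∷-injective; ∷-injectiveʳ; ∷ʳ-injective; ∷ʳ-++; ++-assoc; ++-identityʳ; ++-conicalˡ)
open import Data.List.Relation.Unary.All using (All; []; _∷_)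
import Data.List.Relation.Unary.All as All
import Data.List.Relation.Unary.All.Properties as All
open import Data.List.Relation.Unary.AllPairs using ([]; _∷_)
open import Data.List.Relation.Unary.Unique.Propositional using (Unique)
open import Data.List.Relation.Unary.Any using (here; there)
open import Data.List.Relation.Unary.Linked using ([]; [-])
open import Data.List.Membership.Propositional using (_∈_; _∉_)
open import Data.List.Membership.Propositional.Properties using (∈-++⁺ˡ)
open import Data.Maybe using (just; nothing)
open import Data.Product using (_×_; _,_; ∃-syntax; proj₁; proj₂)
open import Data.Sum using (_⊎_; inj₁; inj₂) renaming (map to ⊎-map)
open import Data.Empty using (⊥-elim)
open import Data.Unit using (tt)
open import Relation.Binary.PropositionalEquality using (_≡_; _≢_; refl; sym; trans; cong; subst)
open import Level using (lift)

⊑-refl : ∀ x → x ⊑ x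
⊑-refl x = [] , ++-identityʳ x

⊑-++ : ∀ x d → x ⊑ (x ++ d)
⊑-++ x d = d , refl

[]⊑ : ∀ x → [] ⊑ x
[]⊑ x = x , refl

⊑-trans : ∀ {x y z} → x ⊑ y → y ⊑ z → x ⊑ z
⊑-trans {x} (d , refl) (d' , refl) = d ++ d' , sym (++-assoc x d d')

⊑-cons : ∀ a {x y} → x ⊑ y → (a ∷ x) ⊑ (a ∷ y)
⊑-cons a (d , e) = d , cong (a ∷_) e

⊑-uncons : ∀ {a b x y} → (a ∷ x) ⊑ (b ∷ y) → a ≡ b × x ⊑ y
⊑-uncons (d , refl) = refl , (d , refl)

⊑-head : ∀ {a b x y} → (a ∷ x) ⊑ (b ∷ y) → a ≡ b
⊑-head p = proj₁ (⊑-uncons p)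

⊑-second : ∀ {a a' b b' x y} → (a ∷ b ∷ x) ⊑ (a' ∷ b' ∷ y) → b ≡ b'
⊑-second p = ⊑-head (proj₂ (⊑-uncons p))

⊑-tail₂ : ∀ {a a' b b' x y} → (a ∷ b ∷ x) ⊑ (a' ∷ b' ∷ y) → x ⊑ y
⊑-tail₂ p = proj₂ (⊑-uncons (proj₂ (⊑-uncons p)))

⊑-[] : ∀ {x} → x ⊑ [] → x ≡ []
⊑-[] {x} (d , e) = ++-conicalˡ x d e

⊑-comparable : ∀ {x y L} → x ⊑ L → y ⊑ L → x ⊑ y ⊎ y ⊑ x
⊑-comparable {[]}    _ _ = inj₁ ([]⊑ _)
⊑-comparable {_ ∷ _} {[]} _ _ = inj₂ ([]⊑ _)
⊑-comparable {_ ∷ _} {_ ∷ _} {[]} (_ , ()) _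
⊑-comparable {a ∷ _} {_ ∷ _} {_ ∷ _} p q with ⊑-uncons p | ⊑-uncons q
... | refl , p' | refl , q' = ⊎-map (⊑-cons a) (⊑-cons a) (⊑-comparable p' q')

⊑-∷ʳ : ∀ {x} p z → x ⊑ (p ∷ʳ z) → x ⊑ p ⊎ x ≡ p ∷ʳ z
⊑-∷ʳ {[]}    p       z _ = inj₁ ([]⊑ p)
⊑-∷ʳ {_ ∷ _} []      z q with ⊑-uncons q
... | refl , r = inj₂ (cong (z ∷_) (⊑-[] r))
⊑-∷ʳ {a ∷ _} (_ ∷ p) z q with ⊑-uncons q
... | refl , r = ⊎-map (⊑-cons a) (cong (a ∷_)) (⊑-∷ʳ p z r)

∈-⊑ : ∀ {a : Action} {c L} → a ∈ c → c ⊑ L → a ∈ L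
∈-⊑ {a} m (d , e) = subst (a ∈_) e (∈-++⁺ˡ m)

∷ʳ₂-++ : ∀ (P : Chronicle) u v y → (P ∷ʳ u) ∷ʳ v ++ y ≡ P ++ u ∷ v ∷ y
∷ʳ₂-++ P u v y = trans (∷ʳ-++ (P ∷ʳ u) v y) (∷ʳ-++ P u (v ∷ y))

addrs-++ : ∀ c d → addrs (c ++ d) ≡ addrs c ++ addrs d
addrs-++ []                 d = refl
addrs-++ (prop _ ξ _ ∷ c) d = cong (ξ ∷_) (addrs-++ c d)
addrs-++ (daimon ∷ c)     d = addrs-++ c d

unique-++ˡ : ∀ (xs : List Address) {ys} → Unique (xs ++ ys) → Unique xs
unique-++ˡ []       _           = []
unique-++ˡ (_ ∷ xs) (x∉ ∷ uniq) = All.++⁻ˡ xs x∉ ∷ unique-++ˡ xs uniq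

alternating-++ : ∀ c d → Alternating (c ++ d) → Alternating c
alternating-++ []           _ _          = tt
alternating-++ (_ ∷ [])     _ _          = tt
alternating-++ (_ ∷ b ∷ c) d (a≢b , alt) = a≢b , alternating-++ (b ∷ c) d alt

chronicle-⊑ : ∀ {B c L} → IsChronicle B L → c ≢ [] → c ⊑ L → IsChronicle B c
chronicle-⊑ {B} {c} (_ , alt , justified , uniq , ✠last) c≢[] (d , refl) =
  c≢[] ,
  alternating-++ c d alt ,
  (λ p a q e → justified p a (q ++ d) (trans (cong (_++ d) e) (++-assoc p (a ∷ q) d))) ,
  unique-++ˡ (addrs c) (subst Unique (addrs-++ c d) uniq) ,
  (λ p q e → ++-conicalˡ q d (✠last p (q ++ d) (trans (cong (_++ d) e) (++-assoc p (daimon ∷ q) d))))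

initialPositive : ∀ {B a c} → Γ B ≡ nothing → IsChronicle B (a ∷ c) → pol a ≡ pos
initialPositive {a = prop pos _ _} _ _ = refl
initialPositive {a = daimon}       _ _ = refl
initialPositive {a = prop neg ξ I} {c} Γ≡nothing (_ , _ , justified , _)
  with justified [] (prop neg ξ I) c refl
... | _ , inj₁ (_ , Γ≡ξ) with trans (sym Γ≡nothing) Γ≡ξ
...   | ()
initialPositive {a = prop neg ξ I} {c} _ _ | _ , inj₂ ([] , _ , _ , _ , () , _)
initialPositive {a = prop neg ξ I} {c} _ _ | _ , inj₂ (_ ∷ _ , _ , _ , _ , () , _)

EndsPositive : Chronicle → Set
EndsPositive c = ∃[ p ] ∃[ a ] (c ≡ p ∷ʳ a × pol a ≡ pos)

Chain : Chronicle → Des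
Chain L c = c ≢ [] × c ⊑ L

comparable⇒coherent : ∀ {x y} → x ⊑ y ⊎ y ⊑ x → Coherent x y
comparable⇒coherent (inj₁ x⊑y) = inj₁ x⊑y
comparable⇒coherent (inj₂ y⊑x) = inj₂ (inj₁ y⊑x)

chainDesign : ∀ {B L} → IsChronicle B L → EndsPositive L → IsDesign B (Chain L)
chainDesign {L = []} chron _ = ⊥-elim (proj₁ chron refl)
chainDesign {B} {L@(a ∷ L')} chron end =
  (λ c (c≢[] , c⊑L) → chronicle-⊑ chron c≢[] c⊑L) ,
  (λ c d (_ , cd⊑L) c≢[] → c≢[] , ⊑-trans (⊑-++ c d) cd⊑L) ,
  (λ c c' (_ , c⊑L) (_ , c'⊑L) → comparable⇒coherent (⊑-comparable c⊑L c'⊑L)) ,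
  (λ c (_ , c⊑L) maximal → subst EndsPositive (maximal L ((λ ()) , ⊑-refl L) c⊑L) end) ,
  λ Γ≡nothing → (L , (λ ()) , ⊑-refl L) , a , initialPositive Γ≡nothing chron , startsWith-a
  where
  startsWith-a : ∀ c → Chain L c → ∃[ q ] (c ≡ a ∷ q)
  startsWith-a []      (c≢[] , _)  = ⊥-elim (c≢[] refl)
  startsWith-a (b ∷ q) (_ , b∷q⊑L) = q , cong (_∷ q) (⊑-head b∷q⊑L)

chain⊆ : ∀ {B D L} → IsDesign B D → D L → Chain L ⊆D D
chain⊆ (_ , prefixClosed , _) dL c (c≢[] , d , refl) = prefixClosed c d dL c≢[]

B⁺ : Address → Base
B⁺ σ = nothing ⊢ (σ ∷ [])

next : Address → Address
next τ = (τ · 0) · 1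

ν₀ ν₁ : Address → Action
ν₀ τ = prop pos τ (0 ∷ [])
ν₁ τ = prop neg (τ · 0) (1 ∷ [])

stem : ℕ → Address → Chronicle
stem zero    τ = []
stem (suc k) τ = ν₀ τ ∷ ν₁ τ ∷ stem k (next τ)

deep : ℕ → Address → Address
deep zero    τ = τ
deep (suc k) τ = deep k (next τ)

data Tip : Set where
  zeroTip daimonTip : Tip

tipAction : Tip → Address → Action
tipAction zeroTip   τ = prop pos τ []
tipAction daimonTip τ = daimon

-- spine (suc k) e τ  is definitionally  ν₀ τ ∷ ν₁ τ ∷ spine k e (next τ).
spine : ℕ → Tip → Address → Chronicle
spine k e τ = stem k τ ∷ʳ tipAction e (deep k τ)

spine≢[] : ∀ {k e τ} → spine k e τ ≢ []
spine≢[] {zero}  ()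
spine≢[] {suc k} ()

spineEndsPositive : ∀ k e τ → EndsPositive (spine k e τ)
spineEndsPositive k zeroTip   τ = stem k τ , _ , refl , refl
spineEndsPositive k daimonTip τ = stem k τ , _ , refl , refl

natD⇒spine : ∀ {n σ c} → natD n σ c → Chain (spine n zeroTip σ) c
natD⇒spine {zero}  refl = (λ ()) , ⊑-refl _
natD⇒spine {suc n} (c≢[] , _ , (c' , c'∈ , refl) , c⊑) =
  c≢[] , ⊑-trans c⊑ (⊑-cons _ (⊑-cons _ (proj₂ (natD⇒spine {n} c'∈))))

spine⇒natD : ∀ {n σ c} → Chain (spine n zeroTip σ) c → natD n σ c
spine⇒natD {zero}  {c = []}    (c≢[] , _) = ⊥-elim (c≢[] refl)
spine⇒natD {zero}  {c = _ ∷ _} (_ , c⊑) with ⊑-uncons c⊑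
... | refl , rest⊑[] = cong (_ ∷_) (⊑-[] rest⊑[])
spine⇒natD {suc n} {σ} (c≢[] , c⊑) =
  c≢[] , spine (suc n) zeroTip σ ,
  (spine n zeroTip (next σ) , spine⇒natD {n} (spine≢[] , ⊑-refl _) , refl) , c⊑

numeralInNat : ∀ n σ → NatSet σ (natD n σ)
numeralInNat n σ = lift (n , (λ _ c → c) , (λ _ c → c))

numeralDaimonFree : ∀ n τ → daimon ∉ spine n zeroTip τ
numeralDaimonFree zero    τ (here ())
numeralDaimonFree zero    τ (there ())
numeralDaimonFree (suc n) τ (here ())
numeralDaimonFree (suc n) τ (there (here ()))
numeralDaimonFree (suc n) τ (there (there m)) = numeralDaimonFree n (next τ) m

pos≢neg : pos ≢ neg
pos≢neg ()

spineHeadPositive : ∀ {k e τ a x} → (a ∷ x) ⊑ spine k e τ → pol a ≡ pos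
spineHeadPositive {zero} {zeroTip}   p with ⊑-head p
... | refl = refl
spineHeadPositive {zero} {daimonTip} p with ⊑-head p
... | refl = refl
spineHeadPositive {suc k}            p with ⊑-head p
... | refl = refl

tip≢ν₀ : ∀ e {τ} → tipAction e τ ≢ ν₀ τ
tip≢ν₀ zeroTip   ()
tip≢ν₀ daimonTip ()

spineMaximal : ∀ {k e k' e' τ} → spine k e τ ⊑ spine k' e' τ → spine k e τ ≡ spine k' e' τ
spineMaximal {zero}  {_} {zero}           p = cong (_∷ []) (⊑-head p)
spineMaximal {zero}  {e} {suc _}          p = ⊥-elim (tip≢ν₀ e (⊑-head p))
spineMaximal {suc _} {_} {zero}  {e'}     p = ⊥-elim (tip≢ν₀ e' (sym (⊑-head p)))
spineMaximal {suc _} {_} {suc _} {_} {τ} p =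
  cong (λ z → ν₀ τ ∷ ν₁ τ ∷ z) (spineMaximal (⊑-tail₂ p))

spineNegativeAgree : ∀ p {a a' k e k' e' τ} →
  (p ∷ʳ a) ⊑ spine k e τ → (p ∷ʳ a') ⊑ spine k' e' τ → pol a ≡ neg → a ≡ a'
spineNegativeAgree []          q _ a⁻ = ⊥-elim (pos≢neg (trans (sym (spineHeadPositive q)) a⁻))
spineNegativeAgree (_ ∷ [])    {k = zero}                (_ , ()) _ _
spineNegativeAgree (_ ∷ [])    {k = suc _} {k' = zero}   _ (_ , ()) _
spineNegativeAgree (_ ∷ [])    {k = suc _} {k' = suc _}  q q' _ = trans (⊑-second q) (sym (⊑-second q'))
spineNegativeAgree (_ ∷ _ ∷ _) {k = zero}                (_ , ()) _ _
spineNegativeAgree (_ ∷ _ ∷ _) {k = suc _} {k' = zero}   _ (_ , ()) _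
spineNegativeAgree (_ ∷ _ ∷ p) {k = suc _} {k' = suc _}  q q' a⁻ =
  spineNegativeAgree p (⊑-tail₂ q) (⊑-tail₂ q') a⁻

coherentSpinePrefixes : ∀ {x y k e k' e' τ} → x ⊑ spine k e τ → y ⊑ spine k' e' τ →
                        Coherent x y → x ⊑ y ⊎ y ⊑ x
coherentSpinePrefixes _ _ (inj₁ x⊑y)        = inj₁ x⊑y
coherentSpinePrefixes _ _ (inj₂ (inj₁ y⊑x)) = inj₂ y⊑x
coherentSpinePrefixes x⊑ y⊑ (inj₂ (inj₂ (p , a , a' , q , q' , refl , refl , a≢a' , a⁻ , _ , _))) =
  ⊥-elim (a≢a' (spineNegativeAgree p (⊑-trans (q , ∷ʳ-++ p a q) x⊑) (⊑-trans (q' , ∷ʳ-++ p a' q') y⊑) a⁻))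

-- The chronicles after which ✠-shortening may place the daimon.
CutPoint : Chronicle → Set
CutPoint c = (c ≡ []) ⊎ (∃[ p ] ∃[ a ] (c ≡ p ∷ʳ a × pol a ≡ neg))

stemCutPoint : ∀ k τ → CutPoint (stem k τ)
stemCutPoint zero    τ = inj₁ refl
stemCutPoint (suc k) τ with stemCutPoint k (next τ)
... | inj₁ e              = inj₂ (ν₀ τ ∷ [] , ν₁ τ , cong (λ z → ν₀ τ ∷ ν₁ τ ∷ z) e , refl)
... | inj₂ (p , a , e , a⁻) = inj₂ (ν₀ τ ∷ ν₁ τ ∷ p , a , cong (λ z → ν₀ τ ∷ ν₁ τ ∷ z) e , a⁻)

cutPointTail : ∀ {a b c} → CutPoint (a ∷ b ∷ c) → CutPoint (b ∷ c)
cutPointTail (inj₁ ())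
cutPointTail (inj₂ ([] , _ , () , _))
cutPointTail (inj₂ (_ ∷ p , a , e , a⁻)) = inj₂ (p , a , ∷-injectiveʳ e , a⁻)

cutPointStem : ∀ {n e τ} c → c ⊑ spine n e τ → CutPoint c → ∃[ k ] (c ≡ stem k τ)
cutPointStem []    _ _ = 0 , refl
cutPointStem (_ ∷ []) _ (inj₁ ())
cutPointStem (_ ∷ []) c⊑ (inj₂ (p , _ , e , a⁻)) with ∷ʳ-injective [] p e
... | refl , refl = ⊥-elim (pos≢neg (trans (sym (spineHeadPositive c⊑)) a⁻))
cutPointStem {zero}  (_ ∷ _ ∷ _) (_ , ()) _
cutPointStem {suc n} (_ ∷ _ ∷ []) c⊑ _ with ⊑-head c⊑ | ⊑-second c⊑
... | refl | refl = 1 , refl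
cutPointStem {suc n} {τ = τ} (_ ∷ _ ∷ c@(_ ∷ _)) c⊑ cut
  with ⊑-head c⊑ | ⊑-second c⊑ | cutPointStem c (⊑-tail₂ c⊑) (cutPointTail (cutPointTail cut))
... | refl | refl | k , c≡stem = suc k , cong (λ z → ν₀ τ ∷ ν₁ τ ∷ z) c≡stem

shortenSpinePrefix : ∀ {n e τ c c''} → c ⊑ spine n e τ → Shorten c c'' →
                     c'' ≡ c ⊎ ∃[ k ] (c'' ≡ spine k daimonTip τ)
shortenSpinePrefix _ (inj₁ c''≡c) = inj₁ c''≡c
shortenSpinePrefix c⊑ (inj₂ (c₁ , c₂ , refl , cut , refl))
  with cutPointStem c₁ (⊑-trans (⊑-++ c₁ c₂) c⊑) cut
... | k , refl = inj₂ (k , refl)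

spineShorten : ∀ k e τ → Shorten (spine k zeroTip τ) (spine k e τ)
spineShorten k zeroTip   τ = inj₁ refl
spineShorten k daimonTip τ = inj₂ (stem k τ , _ , refl , stemCutPoint k τ , refl)

π₀ π₁ : Address → Action
π₀ τ = prop neg τ (0 ∷ [])
π₁ τ = prop pos (τ · 0) (1 ∷ [])

probe : ℕ → Address → Chronicle
probe zero    τ = prop neg τ [] ∷ daimon ∷ []
probe (suc k) τ = π₀ τ ∷ π₁ τ ∷ probe k (next τ)

Tester : Address → Des
Tester τ c = c ≢ [] × ∃[ k ] c ⊑ probe k τ

probeAlternating : ∀ k τ → Alternating (probe k τ)
probeAlternating zero          τ = (λ ()) , tt
probeAlternating (suc zero)    τ = (λ ()) , (λ ()) , probeAlternating zero (next τ)
probeAlternating (suc (suc k)) τ = (λ ()) , (λ ()) , probeAlternating (suc k) (next τ)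

justifiedShift : ∀ τ p a → ActOK (just (next τ) ⊢ []) p a → ActOK (just τ ⊢ []) (π₀ τ ∷ π₁ τ ∷ p) a
justifiedShift τ p (prop pos ξ I) (lk , inj₁ ())
justifiedShift τ p (prop pos ξ I) (lk , inj₂ (ζ , J , i , m , i∈J , e)) =
  lk , inj₂ (ζ , J , i , there (there m) , i∈J , e)
justifiedShift τ .[] (prop neg .(next τ) I) (lk , inj₁ (refl , refl)) =
  lk , inj₂ (π₀ τ ∷ [] , τ · 0 , 1 ∷ [] , 1 , refl , here refl , refl)
justifiedShift τ p (prop neg ξ I) (lk , inj₂ (p' , ζ , J , i , refl , i∈J , e)) =
  lk , inj₂ (π₀ τ ∷ π₁ τ ∷ p' , ζ , J , i , refl , i∈J , e)
justifiedShift τ p daimon _ = tt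

probeJustified : ∀ k τ p a q → probe k τ ≡ p ++ a ∷ q → ActOK (just τ ⊢ []) p a
probeJustified zero    τ []              _ _ refl = [] , inj₁ (refl , refl)
probeJustified zero    τ (_ ∷ [])        _ _ refl = tt
probeJustified zero    τ (_ ∷ _ ∷ [])    _ _ ()
probeJustified zero    τ (_ ∷ _ ∷ _ ∷ _) _ _ ()
probeJustified (suc k) τ []              _ _ refl = [-] , inj₁ (refl , refl)
probeJustified (suc k) τ (_ ∷ [])        _ _ refl = [-] , inj₂ (τ , 0 ∷ [] , 0 , here refl , here refl , refl)
probeJustified (suc k) τ (_ ∷ _ ∷ p)     a q e with ∷-injective e
... | refl , e' with ∷-injective e'
...   | refl , e'' = justifiedShift τ p a (probeJustified k (next τ) p a q e'')

probeDaimonLast : ∀ k τ p q → probe k τ ≡ p ++ daimon ∷ q → q ≡ []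
probeDaimonLast zero    τ []              _ ()
probeDaimonLast zero    τ (_ ∷ [])        _ refl = refl
probeDaimonLast zero    τ (_ ∷ _ ∷ [])    _ ()
probeDaimonLast zero    τ (_ ∷ _ ∷ _ ∷ _) _ ()
probeDaimonLast (suc k) τ []              _ ()
probeDaimonLast (suc k) τ (_ ∷ [])        _ ()
probeDaimonLast (suc k) τ (_ ∷ _ ∷ p)     q e =
  probeDaimonLast k (next τ) p q (∷-injectiveʳ (∷-injectiveʳ e))

-- Addresses of a probe grow strictly in length, hence are distinct.
longer : ∀ (ξ : Address) i → length ξ < length (ξ · i)
longer []      i = ≤-refl
longer (_ ∷ ξ) i = s≤s (longer ξ i)

longer₂ : ∀ τ → length τ < length (next τ)
longer₂ τ = <-trans (longer τ 0) (longer (τ · 0) 1)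

shorter≢ : ∀ {ξ ζ : Address} → length ξ < length ζ → ξ ≢ ζ
shorter≢ lt refl = <-irrefl refl lt

probeAddrsLonger : ∀ k τ → All (λ ξ → length τ ≤ length ξ) (addrs (probe k τ))
probeAddrsLonger zero    τ = ≤-refl ∷ []
probeAddrsLonger (suc k) τ =
  ≤-refl ∷ <⇒≤ (longer τ 0) ∷ All.map (≤-trans (<⇒≤ (longer₂ τ))) (probeAddrsLonger k (next τ))

probeUnique : ∀ k τ → Unique (addrs (probe k τ))
probeUnique zero    τ = [] ∷ []
probeUnique (suc k) τ =
    (shorter≢ (longer τ 0) ∷ All.map (λ h → shorter≢ (<-≤-trans (longer₂ τ) h)) rest)
  ∷ (All.map (λ h → shorter≢ (<-≤-trans (longer (τ · 0) 1) h)) rest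
  ∷ probeUnique k (next τ))
  where
  rest = probeAddrsLonger k (next τ)

probe≢[] : ∀ k τ → probe k τ ≢ []
probe≢[] zero    τ ()
probe≢[] (suc k) τ ()

probeChronicle : ∀ k τ → IsChronicle (just τ ⊢ []) (probe k τ)
probeChronicle k τ =
  probe≢[] k τ , probeAlternating k τ , probeJustified k τ , probeUnique k τ , probeDaimonLast k τ

probeEndsPositive : ∀ k τ → EndsPositive (probe k τ)
probeEndsPositive zero    τ = prop neg τ [] ∷ [] , daimon , refl , refl
probeEndsPositive (suc k) τ with probeEndsPositive k (next τ)
... | p , a , e , a⁺ = π₀ τ ∷ π₁ τ ∷ p , a , cong (λ z → π₀ τ ∷ π₁ τ ∷ z) e , a⁺

coherent-∷ : ∀ a {x y} → Coherent x y → Coherent (a ∷ x) (a ∷ y)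
coherent-∷ a (inj₁ x⊑y)        = inj₁ (⊑-cons a x⊑y)
coherent-∷ a (inj₂ (inj₁ y⊑x)) = inj₂ (inj₁ (⊑-cons a y⊑x))
coherent-∷ a (inj₂ (inj₂ (p , b , b' , q , q' , e , e' , rest))) =
  inj₂ (inj₂ (a ∷ p , b , b' , q , q' , cong (a ∷_) e , cong (a ∷_) e' , rest))

-- Two probes agree until one answers an unfolding the other refutes; there
-- they differ on negative actions with the same address.
probesCoherent : ∀ j k τ {x y} → x ⊑ probe j τ → y ⊑ probe k τ → Coherent x y
probesCoherent _ _ _ {[]}    _ _ = inj₁ ([]⊑ _)
probesCoherent _ _ _ {_ ∷ _} {[]} _ _ = inj₂ (inj₁ ([]⊑ _))
probesCoherent zero zero τ {_ ∷ _} {_ ∷ _} p q = comparable⇒coherent (⊑-comparable p q)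
probesCoherent zero (suc k) τ {_ ∷ x} {_ ∷ y} p q with ⊑-head p | ⊑-head q
... | refl | refl = inj₂ (inj₂ ([] , _ , _ , x , y , refl , refl , (λ ()) , refl , refl , λ ne → ⊥-elim (ne refl)))
probesCoherent (suc j) zero τ {_ ∷ x} {_ ∷ y} p q with ⊑-head p | ⊑-head q
... | refl | refl = inj₂ (inj₂ ([] , _ , _ , x , y , refl , refl , (λ ()) , refl , refl , λ ne → ⊥-elim (ne refl)))
probesCoherent (suc j) (suc k) τ {a ∷ []} {_ ∷ y} p q with ⊑-head p | ⊑-head q
... | refl | refl = inj₁ (⊑-cons a ([]⊑ y))
probesCoherent (suc j) (suc k) τ {a ∷ _ ∷ _} {_ ∷ []} p q with ⊑-head p | ⊑-head q
... | refl | refl = inj₂ (inj₁ (⊑-cons a ([]⊑ _)))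
probesCoherent (suc j) (suc k) τ {a ∷ b ∷ _} {_ ∷ _ ∷ _} p q
  with ⊑-head p | ⊑-head q | ⊑-second p | ⊑-second q
... | refl | refl | refl | refl = coherent-∷ a (coherent-∷ b (probesCoherent j k (next τ) (⊑-tail₂ p) (⊑-tail₂ q)))

testerDesign : ∀ τ → IsDesign (just τ ⊢ []) (Tester τ)
testerDesign τ =
  (λ c (c≢[] , k , c⊑) → chronicle-⊑ (probeChronicle k τ) c≢[] c⊑) ,
  (λ c d (_ , k , cd⊑) c≢[] → c≢[] , k , ⊑-trans (⊑-++ c d) cd⊑) ,
  (λ c c' (_ , j , c⊑) (_ , k , c'⊑) → probesCoherent j k τ c⊑ c'⊑) ,
  (λ c (_ , k , c⊑) maximal →
     subst EndsPositive (maximal (probe k τ) (probe≢[] k τ , k , ⊑-refl _) c⊑) (probeEndsPositive k τ)) ,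
  λ ()

testerFirst : ∀ {τ I} → Tester τ (prop neg τ I ∷ []) → I ≡ [] ⊎ I ≡ 0 ∷ []
testerFirst (_ , zero  , p) with ⊑-head p
... | refl = inj₁ refl
testerFirst (_ , suc _ , p) with ⊑-head p
... | refl = inj₂ refl

testerSecond : ∀ {τ a} → Tester τ (π₀ τ ∷ a ∷ []) → a ≡ π₁ τ
testerSecond (_ , zero  , p) with ⊑-head p
... | ()
testerSecond (_ , suc _ , p) = ⊑-second p

selMono : ∀ {D D' E : Des} → D ⊆D D' → ∀ s c → sel D E s c → sel D' E s c
selMono D⊆D' left  c d = D⊆D' c d
selMono D⊆D' right c e = e

convMono : ∀ {D D' E s c sl} → D ⊆D D' → Conv D E s c sl → Conv D' E s c sl
convMono D⊆D' (done {s} d) = done (selMono D⊆D' s _ d)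
convMono D⊆D' (step {s} ξ I s' c' xs ys d eq d' k) =
  step ξ I s' c' xs ys (selMono D⊆D' s _ d) eq (selMono D⊆D' s' _ d') (convMono D⊆D' k)

emptyStep : ∀ {D E s c} → Conv D E s c [] → sel D E s (c ∷ʳ daimon)
emptyStep (done d) = d
emptyStep (step _ _ _ _ []      _ _ () _ _)
emptyStep (step _ _ _ _ (_ ∷ _) _ _ () _ _)

-- With one pending cut, the positive side plays ✠ or an action on the cut
-- address; the view exposes the remaining interaction as a subterm.
data SingleStep {D E s c ξ s' c'} : Conv D E s c (slot ξ s' c' ∷ []) → Set where
  plays✠ : (d : sel D E s (c ∷ʳ daimon)) → SingleStep (done d)
  cuts   : ∀ I (d : sel D E s (c ∷ʳ prop pos ξ I)) (d' : sel D E s' (c' ∷ʳ prop neg ξ I))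
             (rest : Conv D E s' (c' ∷ʳ prop neg ξ I) (map (λ i → slot (ξ · i) s (c ∷ʳ prop pos ξ I)) I)) →
           SingleStep (step ξ I s' c' [] [] d refl d' rest)

singleStep : ∀ {D E s c ξ s' c'} (conv : Conv D E s c (slot ξ s' c' ∷ [])) → SingleStep conv
singleStep (done d)                             = plays✠ d
singleStep (step _ I _ _ [] [] d refl d' rest)  = cuts I d d' rest
singleStep (step _ _ _ _ [] (_ ∷ _) _ () _ _)
singleStep (step _ _ _ _ (_ ∷ []) _ _ () _ _)
singleStep (step _ _ _ _ (_ ∷ _ ∷ _) _ _ () _ _)

cut : ∀ {D E s c ξ I s' c'} → sel D E s (c ∷ʳ prop pos ξ I) → sel D E s' (c' ∷ʳ prop neg ξ I) →
      Conv D E s' (c' ∷ʳ prop neg ξ I) (map (λ i → slot (ξ · i) s (c ∷ʳ prop pos ξ I)) I) →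
      Conv D E s c (slot ξ s' c' ∷ [])
cut d d' k = step _ _ _ _ [] [] d refl d' k

record Contains (D : Des) (P : Chronicle) (S : Des) : Set where
  constructor containing
  field inside : ∀ a x → S (a ∷ x) → D (P ++ a ∷ x)
open Contains

record Within (D : Des) (P : Chronicle) (S : Des) : Set where
  constructor bounding
  field bounded : ∀ a x → D (P ++ a ∷ x) → S (a ∷ x)
open Within

inside₂ : ∀ {D P S} → Contains D P S → ∀ u v → S (u ∷ v ∷ []) → D ((P ∷ʳ u) ∷ʳ v)
inside₂ {D} {P} h u v s = subst D (sym (∷ʳ-++ P u [ v ])) (inside h u [ v ] s)

bounded₂ : ∀ {D P S} → Within D P S → ∀ u v → D ((P ∷ʳ u) ∷ʳ v) → S (u ∷ v ∷ [])
bounded₂ {D} {P} h u v d = bounded h u [ v ] (subst D (∷ʳ-++ P u [ v ]) d)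

shiftContains : ∀ {D P S S'} u v → (∀ a x → S' (a ∷ x) → S (u ∷ v ∷ a ∷ x)) →
                Contains D P S → Contains D ((P ∷ʳ u) ∷ʳ v) S'
shiftContains {D} {P} u v S'⇒S h = containing λ a x s →
  subst D (sym (∷ʳ₂-++ P u v (a ∷ x))) (inside h u (v ∷ a ∷ x) (S'⇒S a x s))

shiftWithin : ∀ {D P S S'} u v → (∀ a x → S (u ∷ v ∷ a ∷ x) → S' (a ∷ x)) →
              Within D P S → Within D ((P ∷ʳ u) ∷ʳ v) S'
shiftWithin {D} {P} u v S⇒S' h = bounding λ a x d →
  S⇒S' a x (bounded h u (v ∷ a ∷ x) (subst D (∷ʳ₂-++ P u v (a ∷ x)) d))

chain-cons₂ : ∀ {u v L} a x → Chain L (a ∷ x) → Chain (u ∷ v ∷ L) (u ∷ v ∷ a ∷ x)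
chain-cons₂ {u} {v} _ _ (_ , p) = (λ ()) , ⊑-cons u (⊑-cons v p)

chain-tail₂ : ∀ {u v L} a x → Chain (u ∷ v ∷ L) (u ∷ v ∷ a ∷ x) → Chain L (a ∷ x)
chain-tail₂ _ _ (_ , p) = (λ ()) , ⊑-tail₂ p

tester-cons₂ : ∀ {τ} a x → Tester (next τ) (a ∷ x) → Tester τ (π₀ τ ∷ π₁ τ ∷ a ∷ x)
tester-cons₂ _ _ (_ , k , p) = (λ ()) , suc k , ⊑-cons _ (⊑-cons _ p)

tester-tail₂ : ∀ {τ} a x → Tester τ (π₀ τ ∷ π₁ τ ∷ a ∷ x) → Tester (next τ) (a ∷ x)
tester-tail₂ _ _ (_ , zero  , p) with ⊑-head p
... | ()
tester-tail₂ _ _ (_ , suc k , p) = (λ ()) , k , ⊑-tail₂ p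

containsChain : ∀ {D L} → Contains D [] (Chain L) → Chain L ⊆D D
containsChain h []      (c≢[] , _) = ⊥-elim (c≢[] refl)
containsChain h (a ∷ x) c          = inside h a x c

containsSingle : ∀ {D P a} → D (P ∷ʳ a) → Contains D P (Chain (a ∷ []))
containsSingle {D} {P} d = containing single
  where
  single : ∀ b x → Chain (_ ∷ []) (b ∷ x) → D (P ++ b ∷ x)
  single b x (_ , p) with ⊑-uncons p
  ... | refl , x⊑[] rewrite ⊑-[] x⊑[] = d

numeral⊥tester : ∀ n τ P Q {D E} → Contains D P (Chain (spine n zeroTip τ)) → Contains E Q (Tester τ) →
                 Conv D E left P (slot τ right Q ∷ [])
numeral⊥tester zero τ P Q hD hE =
  cut (inside hD _ [] ((λ ()) , _ , refl)) (inside hE _ [] ((λ ()) , 0 , _ , refl))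
      (done (inside₂ hE _ _ ((λ ()) , 0 , _ , refl)))
numeral⊥tester (suc n) τ P Q hD hE =
  cut (inside hD _ [] ((λ ()) , _ , refl)) (inside hE _ [] ((λ ()) , 1 , _ , refl))
      (cut (inside₂ hE _ _ ((λ ()) , 1 , _ , refl)) (inside₂ hD _ _ ((λ ()) , _ , refl))
           (numeral⊥tester n (next τ) _ _ (shiftContains (ν₀ τ) (ν₁ τ) chain-cons₂ hD)
                                          (shiftContains (π₀ τ) (π₁ τ) tester-cons₂ hE)))

containsUnfolding : ∀ {D P u v L} → D (P ∷ʳ u) → D ((P ∷ʳ u) ∷ʳ v) →
                    Contains D ((P ∷ʳ u) ∷ʳ v) (Chain L) → Contains D P (Chain (u ∷ v ∷ L))
containsUnfolding {D} {P} {u} {v} du duv rest = containing grow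
  where
  grow : ∀ a x → Chain (u ∷ v ∷ _) (a ∷ x) → D (P ++ a ∷ x)
  grow a [] (_ , p) with ⊑-head p
  ... | refl = du
  grow a (b ∷ []) (_ , p) with ⊑-head p | ⊑-second p
  ... | refl | refl = subst D (∷ʳ-++ P u [ v ]) duv
  grow a (b ∷ c ∷ z) (_ , p) with ⊑-head p | ⊑-second p
  ... | refl | refl = subst D (∷ʳ₂-++ P u v (c ∷ z)) (inside rest c z ((λ ()) , ⊑-tail₂ p))

testerReveals : ∀ τ P Q {D E} → Within E Q (Tester τ) → Conv D E left P (slot τ right Q ∷ []) →
                ∃[ k ] ∃[ e ] Contains D P (Chain (spine k e τ))
testerReveals τ P Q hE conv with singleStep conv
... | plays✠ d✠ = 0 , daimonTip , containsSingle d✠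
... | cuts I d₀ e₀ rest with testerFirst (bounded hE _ [] e₀)
...   | inj₁ refl = 0 , zeroTip , containsSingle d₀
...   | inj₂ refl with singleStep rest
...     | plays✠ e✠ with testerSecond (bounded₂ hE (π₀ τ) daimon e✠)
...       | ()
testerReveals τ P Q hE conv | cuts _ d₀ e₀ rest | inj₂ refl | cuts J e₁ d₁ rest'
  with testerSecond (bounded₂ hE (π₀ τ) (prop pos (τ · 0) J) e₁)
... | refl with testerReveals (next τ) _ _ (shiftWithin (π₀ τ) (π₁ τ) tester-tail₂ hE) rest'
...   | k , e , above = suc k , e , containsUnfolding d₀ d₁ above

-- If the numeral with k unfoldings converges against E, so does every spine
-- with k unfoldings: the daimon only ends the same interaction earlier.
spineTruncation : ∀ k e τ P Q {D D' E} → Within D P (Chain (spine k zeroTip τ)) →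
                  Contains D' P (Chain (spine k e τ)) →
                  Conv D E left P (slot τ right Q ∷ []) → Conv D' E left P (slot τ right Q ∷ [])
spineTruncation zero daimonTip τ P Q _ lo _ = done (inside lo _ [] ((λ ()) , ⊑-refl _))
spineTruncation zero zeroTip τ P Q up lo conv with singleStep conv
... | plays✠ d✠ with ⊑-head (proj₂ (bounded up _ [] d✠))
...   | ()
spineTruncation zero zeroTip τ P Q up lo conv | cuts I d₀ e₀ rest with ⊑-head (proj₂ (bounded up _ [] d₀))
... | refl = cut (inside lo _ [] ((λ ()) , ⊑-refl _)) e₀ (done (emptyStep rest))
spineTruncation (suc k) e τ P Q up lo conv with singleStep conv
... | plays✠ d✠ with ⊑-head (proj₂ (bounded up _ [] d✠))
...   | ()
spineTruncation (suc k) e τ P Q up lo conv | cuts I d₀ e₀ rest with ⊑-head (proj₂ (bounded up _ [] d₀))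
... | refl with singleStep rest
...   | plays✠ e✠ = cut (inside lo _ [] ((λ ()) , _ , refl)) e₀ (done e✠)
...   | cuts J e₁ d₁ rest' with ⊑-second (proj₂ (bounded₂ up (ν₀ τ) (prop neg (τ · 0) J) d₁))
...     | refl =
  cut (inside lo _ [] ((λ ()) , _ , refl)) e₀
      (cut e₁ (inside₂ lo _ _ ((λ ()) , _ , refl))
           (spineTruncation k e (next τ) _ _ (shiftWithin (ν₀ τ) (ν₁ τ) chain-tail₂ up)
                                             (shiftContains (ν₀ τ) (ν₁ τ) chain-cons₂ lo) rest'))

tester⊥ : ∀ σ → Perp⁺ σ (NatSet σ) (Tester σ)
tester⊥ σ = testerDesign σ , λ { D (lift (n , _ , natD⊆D)) →
  numeral⊥tester n σ [] [] (containing λ a x c → natD⊆D _ (spine⇒natD c)) (containing λ a x t → t) }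

spine⊥ : ∀ k e σ E → Perp⁺ σ (NatSet σ) E → Orth σ (Chain (spine k e σ)) E
spine⊥ k e σ E (_ , orth) =
  spineTruncation k e σ [] [] (bounding λ a x n → natD⇒spine n) (containing λ a x c → c)
                  (orth (natD k σ) (numeralInNat k σ))

biorthOfSpine : ∀ {k e σ D} → IsDesign (B⁺ σ) D → Chain (spine k e σ) ⊆D D → Biorth σ (NatSet σ) D
biorthOfSpine {k} {e} {σ} des spine⊆D = des , λ E perp → convMono spine⊆D (spine⊥ k e σ E perp)

revealSpine : ∀ {σ D} → Biorth σ (NatSet σ) D → ∃[ k ] ∃[ e ] (Chain (spine k e σ) ⊆D D)
revealSpine {σ} (_ , orth) with testerReveals σ [] [] (bounding λ a x t → t) (orth (Tester σ) (tester⊥ σ))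
... | k , e , above = k , e , containsChain above

-- The chain of a spine is material in ℕat^⊥⊥: a smaller element would
-- contain another spine, which is impossible by maximality of spines.
spineMaterial : ∀ {k e σ D} → IsDesign (B⁺ σ) D → D ≐ Chain (spine k e σ) →
                Material (Biorth σ (NatSet σ)) D
spineMaterial {k} {e} {σ} {D} des (D⊆spine , spine⊆D) =
  biorthOfSpine des spine⊆D , λ c → incarnate c , λ inc → inc D (λ _ d → d) (biorthOfSpine des spine⊆D)
  where
  incarnate : ∀ c → D c → Incarnation (Biorth σ (NatSet σ)) D c
  incarnate c dc D' D'⊆D bio' with revealSpine bio'
  ... | k' , e' , spine'⊆D' =
    spine'⊆D' c (subst (λ L → Chain L c) (sym same) (D⊆spine c dc))
    where
    same : spine k' e' σ ≡ spine k e σ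
    same = spineMaximal (proj₂ (D⊆spine _ (D'⊆D _ (spine'⊆D' _ (spine≢[] , ⊑-refl _)))))

materialIsSpine : ∀ {σ D} → Material (Biorth σ (NatSet σ)) D → ∃[ k ] ∃[ e ] (D ≐ Chain (spine k e σ))
materialIsSpine {σ} {D} (bio@(des , _) , material) with revealSpine bio
... | k , e , spine⊆D = k , e , (λ c dc → proj₁ (material c) dc (Chain (spine k e σ)) spine⊆D chainBiorth) , spine⊆D
  where
  chainBiorth : Biorth σ (NatSet σ) (Chain (spine k e σ))
  chainBiorth = biorthOfSpine (chainDesign (proj₁ des _ (spine⊆D _ (spine≢[] , ⊑-refl _))) (spineEndsPositive k e σ))
                              (λ _ c → c)

-- A ✠-shortening of (the chain of) a numeral is the chain of a spine: it
-- contains the shorten of the numeral's maximal chronicle, a spine, and by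
-- coherence nothing beyond it.
shortenedIsSpine : ∀ {n σ D₀ D} → D₀ ⊆D Chain (spine n zeroTip σ) → D₀ (spine n zeroTip σ) →
                   ShortenedFrom (B⁺ σ) D₀ D → ∃[ k ] ∃[ e ] (D ≐ Chain (spine k e σ))
shortenedIsSpine {n} {σ} {D₀} {D} D₀⊆ numeral∈ (des@(chronicles , _ , coherent , _) , shortens , covered) =
  spineOf (shortens _ numeral∈)
  where
  withinSpine : ∀ x → D x → ∃[ k ] ∃[ e ] (x ⊑ spine k e σ)
  withinSpine x dx with covered x dx
  ... | c , c'' , c∈ , sh , x⊑c'' with shortenSpinePrefix (proj₂ (D₀⊆ c c∈)) sh
  ...   | inj₁ refl       = n , zeroTip , ⊑-trans x⊑c'' (proj₂ (D₀⊆ c c∈))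
  ...   | inj₂ (k , refl) = k , daimonTip , x⊑c''

  noneBeyond : ∀ {k e} → D (spine k e σ) → D ⊆D Chain (spine k e σ)
  noneBeyond dspine x dx with withinSpine x dx
  ... | _ , _ , x⊑ with coherentSpinePrefixes x⊑ (⊑-refl _) (coherent x _ dx dspine)
  ...   | inj₁ x⊑spine = proj₁ (chronicles x dx) , x⊑spine
  ...   | inj₂ spine⊑x = proj₁ (chronicles x dx) , subst (x ⊑_) (sym (spineMaximal (⊑-trans spine⊑x x⊑))) x⊑

  spineOf : ∃[ c' ] (Shorten (spine n zeroTip σ) c' × D c') → ∃[ k ] ∃[ e ] (D ≐ Chain (spine k e σ))
  spineOf (c' , sh , dc') with shortenSpinePrefix (⊑-refl _) sh
  ... | inj₁ refl       = n , zeroTip , noneBeyond dc' , chain⊆ des dc'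
  ... | inj₂ (k , refl) = k , daimonTip , noneBeyond dc' , chain⊆ des dc'

spineShortened : ∀ {k e σ D} → IsDesign (B⁺ σ) D → D ≐ Chain (spine k e σ) →
                 ShortenedFrom (B⁺ σ) (natD k σ) D
spineShortened {k} {e} {σ} {D} des (D⊆spine , spine⊆D) = des , shortens , covered
  where
  shortens : ∀ c → natD k σ c → ∃[ c' ] (Shorten c c' × D c')
  shortens c c∈ with natD⇒spine {k} c∈
  ... | c≢[] , c⊑ with ⊑-∷ʳ (stem k σ) _ c⊑
  ...   | inj₁ c⊑stem = c , inj₁ refl , spine⊆D c (c≢[] , ⊑-trans c⊑stem (⊑-++ _ _))
  ...   | inj₂ refl   = spine k e σ , spineShorten k e σ , spine⊆D _ (spine≢[] , ⊑-refl _)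
  covered : ∀ c' → D c' → ∃[ c ] ∃[ c'' ] (natD k σ c × Shorten c c'' × c' ⊑ c'')
  covered c' dc' = spine k zeroTip σ , spine k e σ , spine⇒natD {k} (spine≢[] , ⊑-refl _) ,
                   spineShorten k e σ , proj₂ (D⊆spine c' dc')

mainTheorem1 : (σ : Address) → Principal σ (NatSet σ)
mainTheorem1 σ = daimonFree , λ D → materialShortened D , shortenedMaterial D
  where
  daimonFree : ∀ D → NatSet σ D → DaimonFree D
  daimonFree D (lift (n , D⊆natD , _)) c dc ✠∈c =
    numeralDaimonFree n σ (∈-⊑ ✠∈c (proj₂ (natD⇒spine {n} (D⊆natD c dc))))

  materialShortened : ∀ D → Material (Biorth σ (NatSet σ)) D → DaimonShort (B⁺ σ) (NatSet σ) D
  materialShortened D mat with materialIsSpine mat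
  ... | k , e , D≐spine =
    natD k σ , numeralInNat k σ , spineShortened (proj₁ (proj₁ mat)) D≐spine

  shortenedMaterial : ∀ D → DaimonShort (B⁺ σ) (NatSet σ) D → Material (Biorth σ (NatSet σ)) D
  shortenedMaterial D (D₀ , lift (n , D₀⊆natD , natD⊆D₀) , sh)
    with shortenedIsSpine (λ c d → natD⇒spine {n} (D₀⊆natD c d))
                          (natD⊆D₀ _ (spine⇒natD {n} (spine≢[] , ⊑-refl _))) sh
  ... | k , e , D≐spine = spineMaterial (proj₁ sh) D≐spine
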